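{- 1. Let $M\in$ dCBN. Then $(\mathrm{BT}_n(M))^n = \mathrm{BT}_{!}(M^n)$. 2. Let $M\in$ dCBV. Then $(\mathrm{BT}_v(M))^v = \mathrm{BT}_{!}(M^v)$.
   Context: $\mathrm{BT}_{!}(M)$ is the dBang Böhm tree: the union (supremum) of the set of approximants $A\sqsubseteq N$ with $M\to_{\mathtt{dBang}}^* N$ under full dBang reduction (dBang terms $M ::= x \mid \lambda x M \mid MN \mid {!}M \mid \mathrm{der}(M) \mid M[N/x]$). For $\circ\in\{n,v\}$, $\mathrm{BT}_\circ(M)=\bigcup\{A_\circ\mid M\to_\circ^* N,\ A_\circ\sqsubseteq N\}$ with dCBN approximants $A_n ::= \bot\mid N_\lambda\mid\lambda xA_n$, $N_\lambda ::= x\mid N_\lambda A_n$, and dCBV approximants $A_v ::= \bot\mid A_\lambda\mid\lambda xA_v\mid A_v[A_{x\lambda}/x]$, $A_\lambda ::= x\mid A_\lambda A_v\mid A_\lambda[A_{x\lambda}/x]$, $A_{x\lambda} ::= A_\lambda A_v\mid A_{x\lambda}[A_{x\lambda}/x]$. Translations: $x^n=x$, $(\lambda xM)^n=\lambda xM^n$, $(MN)^n=M^n\,{!}N^n$, $(M[N/x])^n=M^n[{!}N^n/x]$; $x^v={!}x$, $(\lambda xM)^v={!}(\lambda xM^v)$, $(MN)^v=L\langle P\rangle N^v$ if $M^v=L\langle{!}P\rangle$ and $\mathrm{der}(M^v)N^v$ otherwise, $(M[N/x])^v=M^v[N^v/x]$; both extended with $\bot^n=\bot^v=\bot$. -}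

module Defs where

open import Data.Nat using (ℕ; zero; suc)
open import Data.Fin using (Fin; zero; suc)
open import Data.Product using (Σ; ∃; _×_; _,_)
open import Data.Maybe using (Maybe; just; nothing)
open import Relation.Binary.Construct.Closure.ReflexiveTransitive using (Star)

-- Variable `zero` is the most recently
-- bound one.  In an explicit substitution  M [ N ]  (paper: M[N/x]) the
-- variable x is `zero` in M.  Both syntaxes contain ⊥ (for approximants);
-- genuine terms are the ⊥-free ones (predicates PureΛ, PureB).

ext : ∀ {n m} → (Fin n → Fin m) → Fin (suc n) → Fin (suc m)
ext ρ zero    = zero
ext ρ (suc i) = suc (ρ i)

data Λ (n : ℕ) : Set where
  lvar : Fin n → Λ n
  llam : Λ (suc n) → Λ n
  lapp : Λ n → Λ n → Λ n
  les  : Λ (suc n) → Λ n → Λ n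
  lbot : Λ n

data PureΛ {n : ℕ} : Λ n → Set where
  var : ∀ {i} → PureΛ (lvar i)
  lam : ∀ {M} → PureΛ M → PureΛ (llam M)
  app : ∀ {M N} → PureΛ M → PureΛ N → PureΛ (lapp M N)
  es  : ∀ {M N} → PureΛ M → PureΛ N → PureΛ (les M N)

renΛ : ∀ {n m} → (Fin n → Fin m) → Λ n → Λ m
renΛ ρ (lvar i)  = lvar (ρ i)
renΛ ρ (llam M)  = llam (renΛ (ext ρ) M)
renΛ ρ (lapp M N) = lapp (renΛ ρ M) (renΛ ρ N)
renΛ ρ (les M N) = les (renΛ (ext ρ) M) (renΛ ρ N)
renΛ ρ lbot      = lbot

extsΛ : ∀ {n m} → (Fin n → Λ m) → Fin (suc n) → Λ (suc m)
extsΛ σ zero    = lvar zero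
extsΛ σ (suc i) = renΛ suc (σ i)

subΛ : ∀ {n m} → (Fin n → Λ m) → Λ n → Λ m
subΛ σ (lvar i)  = σ i
subΛ σ (llam M)  = llam (subΛ (extsΛ σ) M)
subΛ σ (lapp M N) = lapp (subΛ σ M) (subΛ σ N)
subΛ σ (les M N) = les (subΛ (extsΛ σ) M) (subΛ σ N)
subΛ σ lbot      = lbot

sub0Λ : ∀ {n} → Λ (suc n) → Λ n → Λ n
sub0Λ {n} M N = subΛ σ M
  where
  σ : Fin (suc n) → Λ n
  σ zero    = N
  σ (suc i) = lvar i

-- substitution contexts L ::= □ | L[N/x];  plugging a term of scope m
-- into L : SLΛ n m gives a term of scope n.
data SLΛ : ℕ → ℕ → Set where
  ◻   : ∀ {n} → SLΛ n n
  _⟦_⟧ : ∀ {n m} → SLΛ (suc n) m → Λ n → SLΛ n m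

plugΛ : ∀ {n m} → SLΛ n m → Λ m → Λ n
plugΛ ◻ T         = T
plugΛ (L ⟦ N ⟧) T = les (plugΛ L T) N

ρΛ : ∀ {n m} → SLΛ n m → Fin n → Fin m
ρΛ ◻ i         = i
ρΛ (L ⟦ N ⟧) i = ρΛ L (suc i)

data ValueΛ {n : ℕ} : Λ n → Set where
  var : ∀ {i} → ValueΛ (lvar i)
  lam : ∀ {M} → ValueΛ (llam M)

-- dCBN root steps:  L⟨λx.M⟩N → L⟨M[N/x]⟩ ,  M[N/x] → M{N/x}
data _↦n_ {n : ℕ} : Λ n → Λ n → Set where
  dB : ∀ {m} (L : SLΛ n m) (M : Λ (suc m)) (N : Λ n) →
       lapp (plugΛ L (llam M)) N ↦n plugΛ L (les M (renΛ (ρΛ L) N))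
  s  : (M : Λ (suc n)) (N : Λ n) → les M N ↦n sub0Λ M N

-- dCBV root steps:  L⟨λx.M⟩N → L⟨M[N/x]⟩ ,  M[L⟨V⟩/x] → L⟨M{V/x}⟩
data _↦v_ {n : ℕ} : Λ n → Λ n → Set where
  dB : ∀ {m} (L : SLΛ n m) (M : Λ (suc m)) (N : Λ n) →
       lapp (plugΛ L (llam M)) N ↦v plugΛ L (les M (renΛ (ρΛ L) N))
  sv : ∀ {m} (M : Λ (suc n)) (L : SLΛ n m) (V : Λ m) → ValueΛ V →
       les M (plugΛ L V) ↦v plugΛ L (sub0Λ (renΛ (ext (ρΛ L)) M) V)

data _→n_ : ∀ {n} → Λ n → Λ n → Set where
  root : ∀ {n} {M N : Λ n} → M ↦n N → M →n N
  lam  : ∀ {n} {M M' : Λ (suc n)} → M →n M' → llam M →n llam M'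
  appl : ∀ {n} {M M' N : Λ n} → M →n M' → lapp M N →n lapp M' N
  appr : ∀ {n} {M N N' : Λ n} → N →n N' → lapp M N →n lapp M N'
  esl  : ∀ {n} {M M' : Λ (suc n)} {N : Λ n} → M →n M' → les M N →n les M' N
  esr  : ∀ {n} {M : Λ (suc n)} {N N' : Λ n} → N →n N' → les M N →n les M N'

data _→v_ : ∀ {n} → Λ n → Λ n → Set where
  root : ∀ {n} {M N : Λ n} → M ↦v N → M →v N
  lam  : ∀ {n} {M M' : Λ (suc n)} → M →v M' → llam M →v llam M'
  appl : ∀ {n} {M M' N : Λ n} → M →v M' → lapp M N →v lapp M' N
  appr : ∀ {n} {M N N' : Λ n} → N →v N' → lapp M N →v lapp M N'
  esl  : ∀ {n} {M M' : Λ (suc n)} {N : Λ n} → M →v M' → les M N →v les M' N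
  esr  : ∀ {n} {M : Λ (suc n)} {N N' : Λ n} → N →v N' → les M N →v les M N'

data _⊑Λ_ : ∀ {n} → Λ n → Λ n → Set where
  bot : ∀ {n} {M : Λ n} → lbot ⊑Λ M
  var : ∀ {n} {i : Fin n} → lvar i ⊑Λ lvar i
  lam : ∀ {n} {A M : Λ (suc n)} → A ⊑Λ M → llam A ⊑Λ llam M
  app : ∀ {n} {A B M N : Λ n} → A ⊑Λ M → B ⊑Λ N → lapp A B ⊑Λ lapp M N
  es  : ∀ {n} {A M : Λ (suc n)} {B N : Λ n} → A ⊑Λ M → B ⊑Λ N → les A B ⊑Λ les M N

mutual
  data IsAn : ∀ {n} → Λ n → Set where
    bot : ∀ {n} → IsAn (lbot {n})
    neu : ∀ {n} {A : Λ n} → IsNλ A → IsAn A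
    lam : ∀ {n} {A : Λ (suc n)} → IsAn A → IsAn (llam A)

  data IsNλ : ∀ {n} → Λ n → Set where
    var : ∀ {n} {i : Fin n} → IsNλ (lvar i)
    app : ∀ {n} {A B : Λ n} → IsNλ A → IsAn B → IsNλ (lapp A B)

mutual
  data IsAv : ∀ {n} → Λ n → Set where
    bot : ∀ {n} → IsAv (lbot {n})
    neu : ∀ {n} {A : Λ n} → IsAλ A → IsAv A
    lam : ∀ {n} {A : Λ (suc n)} → IsAv A → IsAv (llam A)
    es  : ∀ {n} {A : Λ (suc n)} {B : Λ n} → IsAv A → IsAxλ B → IsAv (les A B)

  data IsAλ : ∀ {n} → Λ n → Set where
    var : ∀ {n} {i : Fin n} → IsAλ (lvar i)
    app : ∀ {n} {A B : Λ n} → IsAλ A → IsAv B → IsAλ (lapp A B)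
    es  : ∀ {n} {A : Λ (suc n)} {B : Λ n} → IsAλ A → IsAxλ B → IsAλ (les A B)

  data IsAxλ : ∀ {n} → Λ n → Set where
    app : ∀ {n} {A B : Λ n} → IsAλ A → IsAv B → IsAxλ (lapp A B)
    es  : ∀ {n} {A : Λ (suc n)} {B : Λ n} → IsAxλ A → IsAxλ B → IsAxλ (les A B)

data Bang (n : ℕ) : Set where
  bvar  : Fin n → Bang n
  blam  : Bang (suc n) → Bang n
  bapp  : Bang n → Bang n → Bang n
  bbang : Bang n → Bang n
  bder  : Bang n → Bang n
  bes   : Bang (suc n) → Bang n → Bang n
  bbot  : Bang n

renB : ∀ {n m} → (Fin n → Fin m) → Bang n → Bang m
renB ρ (bvar i)   = bvar (ρ i)
renB ρ (blam M)   = blam (renB (ext ρ) M)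
renB ρ (bapp M N) = bapp (renB ρ M) (renB ρ N)
renB ρ (bbang M)  = bbang (renB ρ M)
renB ρ (bder M)   = bder (renB ρ M)
renB ρ (bes M N)  = bes (renB (ext ρ) M) (renB ρ N)
renB ρ bbot       = bbot

extsB : ∀ {n m} → (Fin n → Bang m) → Fin (suc n) → Bang (suc m)
extsB σ zero    = bvar zero
extsB σ (suc i) = renB suc (σ i)

subB : ∀ {n m} → (Fin n → Bang m) → Bang n → Bang m
subB σ (bvar i)   = σ i
subB σ (blam M)   = blam (subB (extsB σ) M)
subB σ (bapp M N) = bapp (subB σ M) (subB σ N)
subB σ (bbang M)  = bbang (subB σ M)
subB σ (bder M)   = bder (subB σ M)
subB σ (bes M N)  = bes (subB (extsB σ) M) (subB σ N)
subB σ bbot       = bbot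

sub0B : ∀ {n} → Bang (suc n) → Bang n → Bang n
sub0B {n} M N = subB σ M
  where
  σ : Fin (suc n) → Bang n
  σ zero    = N
  σ (suc i) = bvar i

data SLB : ℕ → ℕ → Set where
  ◻   : ∀ {n} → SLB n n
  _⟦_⟧ : ∀ {n m} → SLB (suc n) m → Bang n → SLB n m

plugB : ∀ {n m} → SLB n m → Bang m → Bang n
plugB ◻ T         = T
plugB (L ⟦ N ⟧) T = bes (plugB L T) N

ρB : ∀ {n m} → SLB n m → Fin n → Fin m
ρB ◻ i         = i
ρB (L ⟦ N ⟧) i = ρB L (suc i)

-- dBang root steps:
--   dB : L⟨λx.M⟩N → L⟨M[N/x]⟩
--   s! : M[L⟨!N⟩/x] → L⟨M{N/x}⟩
--   d! : der(L⟨!N⟩) → L⟨N⟩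
data _↦!_ {n : ℕ} : Bang n → Bang n → Set where
  dB : ∀ {m} (L : SLB n m) (M : Bang (suc m)) (N : Bang n) →
       bapp (plugB L (blam M)) N ↦! plugB L (bes M (renB (ρB L) N))
  s! : ∀ {m} (M : Bang (suc n)) (L : SLB n m) (N : Bang m) →
       bes M (plugB L (bbang N)) ↦! plugB L (sub0B (renB (ext (ρB L)) M) N)
  d! : ∀ {m} (L : SLB n m) (N : Bang m) →
       bder (plugB L (bbang N)) ↦! plugB L N

data _→!_ : ∀ {n} → Bang n → Bang n → Set where
  root : ∀ {n} {M N : Bang n} → M ↦! N → M →! N
  lam  : ∀ {n} {M M' : Bang (suc n)} → M →! M' → blam M →! blam M'
  appl : ∀ {n} {M M' N : Bang n} → M →! M' → bapp M N →! bapp M' N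
  appr : ∀ {n} {M N N' : Bang n} → N →! N' → bapp M N →! bapp M N'
  bang : ∀ {n} {M M' : Bang n} → M →! M' → bbang M →! bbang M'
  der  : ∀ {n} {M M' : Bang n} → M →! M' → bder M →! bder M'
  esl  : ∀ {n} {M M' : Bang (suc n)} {N : Bang n} → M →! M' → bes M N →! bes M' N
  esr  : ∀ {n} {M : Bang (suc n)} {N N' : Bang n} → N →! N' → bes M N →! bes M N'

data _⊑B_ : ∀ {n} → Bang n → Bang n → Set where
  bot  : ∀ {n} {M : Bang n} → bbot ⊑B M
  var  : ∀ {n} {i : Fin n} → bvar i ⊑B bvar i
  lam  : ∀ {n} {A M : Bang (suc n)} → A ⊑B M → blam A ⊑B blam M
  app  : ∀ {n} {A B M N : Bang n} → A ⊑B M → B ⊑B N → bapp A B ⊑B bapp M N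
  bang : ∀ {n} {A M : Bang n} → A ⊑B M → bbang A ⊑B bbang M
  der  : ∀ {n} {A M : Bang n} → A ⊑B M → bder A ⊑B bder M
  es   : ∀ {n} {A M : Bang (suc n)} {B N : Bang n} → A ⊑B M → B ⊑B N → bes A B ⊑B bes M N

-- dBang approximants (the approximant version of full dBang normal forms,
-- ⊥ never in head position nor as content of an ES):
--   A_! ::= ⊥ | A_ne | λx A_! | !A_! | A_![A_ne/x]
--   A_ne ::= x | A_ne A_! | der(A_ne) | A_ne[A_ne/x]
mutual
  data IsA! : ∀ {n} → Bang n → Set where
    bot  : ∀ {n} → IsA! (bbot {n})
    neu  : ∀ {n} {A : Bang n} → IsAne A → IsA! A
    lam  : ∀ {n} {A : Bang (suc n)} → IsA! A → IsA! (blam A)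
    bang : ∀ {n} {A : Bang n} → IsA! A → IsA! (bbang A)
    es   : ∀ {n} {A : Bang (suc n)} {B : Bang n} → IsA! A → IsAne B → IsA! (bes A B)

  data IsAne : ∀ {n} → Bang n → Set where
    var : ∀ {n} {i : Fin n} → IsAne (bvar i)
    app : ∀ {n} {A B : Bang n} → IsAne A → IsA! B → IsAne (bapp A B)
    der : ∀ {n} {A : Bang n} → IsAne A → IsAne (bder A)
    es  : ∀ {n} {A : Bang (suc n)} {B : Bang n} → IsAne A → IsAne B → IsAne (bes A B)

_ⁿ : ∀ {n} → Λ n → Bang n
lvar i ⁿ   = bvar i
llam M ⁿ   = blam (M ⁿ)
lapp M N ⁿ = bapp (M ⁿ) (bbang (N ⁿ))
les M N ⁿ  = bes (M ⁿ) (bbang (N ⁿ))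
lbot ⁿ     = bbot

splitBang : ∀ {n} → Bang n → Maybe (Σ ℕ λ m → SLB n m × Bang m)
splitBang (bbang P) = just (_ , ◻ , P)
splitBang (bes M N) with splitBang M
... | just (m , L , P) = just (m , L ⟦ N ⟧ , P)
... | nothing = nothing
splitBang _ = nothing

appᵛ : ∀ {n} → Bang n → Bang n → Bang n
appᵛ M N with splitBang M
... | just (_ , L , P) = bapp (plugB L P) N
... | nothing = bapp (bder M) N

_ᵛ : ∀ {n} → Λ n → Bang n
lvar i ᵛ   = bbang (bvar i)
llam M ᵛ   = bbang (blam (M ᵛ))
lapp M N ᵛ = appᵛ (M ᵛ) (N ᵛ)
les M N ᵛ  = bes (M ᵛ) (N ᵛ)
lbot ᵛ     = bbot

-- Böhm trees.  A Böhm tree (supremum of a directed set of finite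
-- approximants) is represented by the set of finite approximants below it.

BT! : ∀ {n} → Bang n → Bang n → Set
BT! M A = ∃ λ N → Star _→!_ M N × A ⊑B N

BTn : ∀ {n} → Λ n → Λ n → Set
BTn M A = IsAn A × ∃ λ N → Star _→n_ M N × A ⊑Λ N

BTv : ∀ {n} → Λ n → Λ n → Set
BTv M A = IsAv A × ∃ λ N → Star _→v_ M N × A ⊑Λ N

-- finite approximants below (BT_n(M))ⁿ = ⋃ { Aⁿ | A ∈ BT_n(M) }
BTnⁿ : ∀ {n} → Λ n → Bang n → Set
BTnⁿ M B = ∃ λ A → BTn M A × B ⊑B (A ⁿ)

BTvᵛ : ∀ {n} → Λ n → Bang n → Set
BTvᵛ M B = ∃ λ A → BTv M A × B ⊑B (A ᵛ)

-- equality of (possibly infinite) dBang trees given by their sets of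
-- finite dBang approximants
_≡ᵀ_ : ∀ {n} → (Bang n → Set) → (Bang n → Set) → Set
_≡ᵀ_ {n} T U = (B : Bang n) → IsA! B → (T B → U B) × (U B → T B)

-- Each translation is a simulation.  A relation between source and dBang terms containing the
-- graph of the translation is preserved by reduction in both directions (in call-by-value up to
-- the administrative d! steps that strip a der(!…)), so M and its translation reach related terms.
-- A source approximant below a reduct N translates to an approximant below a reduct of any term
-- related to N; conversely every dBang approximant below a term related to N lies below the
-- translation of a source approximant below N.  Hence both sides have the same finite approximants.

module Submission where

open import Defs
open import Data.Nat using (ℕ; zero; suc)
open import Data.Fin using (Fin; zero; suc)
open import Data.Product using (Σ; ∃; _×_; _,_; proj₁; proj₂)
open import Data.Maybe using (just; nothing)
open import Data.Empty using (⊥-elim) renaming (⊥ to Empty)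
open import Relation.Binary.PropositionalEquality using (_≡_; refl; sym; cong; cong₂; subst)
open import Relation.Binary.Construct.Closure.ReflexiveTransitive using (Star; ε; _◅_; _◅◅_; gmap; return)

ext-cong : ∀ {n m} {ρ ρ' : Fin n → Fin m} → (∀ i → ρ i ≡ ρ' i) → ∀ i → ext ρ i ≡ ext ρ' i
ext-cong h zero    = refl
ext-cong h (suc i) = cong suc (h i)

ext-id : ∀ {n} {ρ : Fin n → Fin n} → (∀ i → ρ i ≡ i) → ∀ i → ext ρ i ≡ i
ext-id h zero    = refl
ext-id h (suc i) = cong suc (h i)

renB-id : ∀ {n} {ρ : Fin n → Fin n} → (∀ i → ρ i ≡ i) → (X : Bang n) → renB ρ X ≡ X
renB-id h (bvar i)   = cong bvar (h i)
renB-id h (blam X)   = cong blam (renB-id (ext-id h) X)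
renB-id h (bapp X Y) = cong₂ bapp (renB-id h X) (renB-id h Y)
renB-id h (bbang X)  = cong bbang (renB-id h X)
renB-id h (bder X)   = cong bder (renB-id h X)
renB-id h (bes X Y)  = cong₂ bes (renB-id (ext-id h) X) (renB-id h Y)
renB-id h bbot       = refl

⊑B-trans : ∀ {n} {A B C : Bang n} → A ⊑B B → B ⊑B C → A ⊑B C
⊑B-trans bot        _          = bot
⊑B-trans var        var        = var
⊑B-trans (lam p)    (lam q)    = lam (⊑B-trans p q)
⊑B-trans (app p p') (app q q') = app (⊑B-trans p q) (⊑B-trans p' q')
⊑B-trans (bang p)   (bang q)   = bang (⊑B-trans p q)
⊑B-trans (der p)    (der q)    = der (⊑B-trans p q)
⊑B-trans (es p p')  (es q q')  = es (⊑B-trans p q) (⊑B-trans p' q')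

star-simulation : {A B : Set} {_R_ : A → B → Set} {_⟶_ : A → A → Set} {_⟿_ : B → B → Set} →
  (∀ {x x' y} → x ⟶ x' → x R y → ∃ λ y' → Star _⟿_ y y' × x' R y') →
  ∀ {x x' y} → Star _⟶_ x x' → x R y → ∃ λ y' → Star _⟿_ y y' × x' R y'
star-simulation simulate ε              xRy = _ , ε , xRy
star-simulation simulate (step ◅ steps) xRy with simulate step xRy
... | _ , ts , x'Ry' with star-simulation simulate steps x'Ry'
...   | y'' , ts' , x''Ry'' = y'' , ts ◅◅ ts' , x''Ry''

lockstep-simulation : {A B : Set} {_R_ : A → B → Set} {_⟶_ : A → A → Set} {_⟿_ : B → B → Set} →
  (∀ {x x' y} → x ⟶ x' → x R y → ∃ λ y' → y ⟿ y' × x' R y') →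
  ∀ {x x' y} → Star _⟶_ x x' → x R y → ∃ λ y' → Star _⟿_ y y' × x' R y'
lockstep-simulation simulate = star-simulation λ step xRy →
  let y' , t , x'Ry' = simulate step xRy in y' , return t , x'Ry'

module CallByName where

  data _≈ⁿ_ : ∀ {n} → Λ n → Bang n → Set where
    var : ∀ {n} {i : Fin n} → lvar i ≈ⁿ bvar i
    lam : ∀ {n} {M : Λ (suc n)} {X} → M ≈ⁿ X → llam M ≈ⁿ blam X
    app : ∀ {n} {M N : Λ n} {X Y} → M ≈ⁿ X → N ≈ⁿ Y → lapp M N ≈ⁿ bapp X (bbang Y)
    es  : ∀ {n} {M : Λ (suc n)} {N : Λ n} {X Y} → M ≈ⁿ X → N ≈ⁿ Y → les M N ≈ⁿ bes X (bbang Y)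
    bot : ∀ {n} → lbot {n} ≈ⁿ bbot

  ≈ⁿ-translation : ∀ {n} (M : Λ n) → M ≈ⁿ (M ⁿ)
  ≈ⁿ-translation (lvar i)   = var
  ≈ⁿ-translation (llam M)   = lam (≈ⁿ-translation M)
  ≈ⁿ-translation (lapp M N) = app (≈ⁿ-translation M) (≈ⁿ-translation N)
  ≈ⁿ-translation (les M N)  = es (≈ⁿ-translation M) (≈ⁿ-translation N)
  ≈ⁿ-translation lbot       = bot

  ≈ⁿ-functional : ∀ {n} {M : Λ n} {X} → M ≈ⁿ X → X ≡ M ⁿ
  ≈ⁿ-functional var        = refl
  ≈ⁿ-functional (lam r)    = cong blam (≈ⁿ-functional r)
  ≈ⁿ-functional (app r r') = cong₂ (λ X Y → bapp X (bbang Y)) (≈ⁿ-functional r) (≈ⁿ-functional r')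
  ≈ⁿ-functional (es r r')  = cong₂ (λ X Y → bes X (bbang Y)) (≈ⁿ-functional r) (≈ⁿ-functional r')
  ≈ⁿ-functional bot        = refl

  ≈ⁿ-ren : ∀ {n m} {ρ ρ' : Fin n → Fin m} → (∀ i → ρ' i ≡ ρ i) →
           ∀ {M X} → M ≈ⁿ X → renΛ ρ M ≈ⁿ renB ρ' X
  ≈ⁿ-ren h (var {i = i}) rewrite h i = var
  ≈ⁿ-ren h (lam r)    = lam (≈ⁿ-ren (ext-cong h) r)
  ≈ⁿ-ren h (app r r') = app (≈ⁿ-ren h r) (≈ⁿ-ren h r')
  ≈ⁿ-ren h (es r r')  = es (≈ⁿ-ren (ext-cong h) r) (≈ⁿ-ren h r')
  ≈ⁿ-ren h bot        = bot

  ≈ⁿ-exts : ∀ {n m} {σ : Fin n → Λ m} {τ : Fin n → Bang m} → (∀ i → σ i ≈ⁿ τ i) →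
            ∀ i → extsΛ σ i ≈ⁿ extsB τ i
  ≈ⁿ-exts h zero    = var
  ≈ⁿ-exts h (suc i) = ≈ⁿ-ren (λ _ → refl) (h i)

  ≈ⁿ-sub : ∀ {n m} {σ : Fin n → Λ m} {τ : Fin n → Bang m} → (∀ i → σ i ≈ⁿ τ i) →
           ∀ {M X} → M ≈ⁿ X → subΛ σ M ≈ⁿ subB τ X
  ≈ⁿ-sub h var        = h _
  ≈ⁿ-sub h (lam r)    = lam (≈ⁿ-sub (≈ⁿ-exts h) r)
  ≈ⁿ-sub h (app r r') = app (≈ⁿ-sub h r) (≈ⁿ-sub h r')
  ≈ⁿ-sub h (es r r')  = es (≈ⁿ-sub (≈ⁿ-exts h) r) (≈ⁿ-sub h r')
  ≈ⁿ-sub h bot        = bot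

  ≈ⁿ-sub0 : ∀ {n} {M : Λ (suc n)} {N X Y} → M ≈ⁿ X → N ≈ⁿ Y → sub0Λ M N ≈ⁿ sub0B X Y
  ≈ⁿ-sub0 r r' = ≈ⁿ-sub (λ { zero → r' ; (suc i) → var }) r

  data _≈ᴸ_ : ∀ {n m} → SLΛ n m → SLB n m → Set where
    ◻    : ∀ {n} → ◻ {n} ≈ᴸ ◻
    _⟦_⟧ : ∀ {n m} {L : SLΛ (suc n) m} {L' : SLB (suc n) m} {N Y} →
           L ≈ᴸ L' → N ≈ⁿ Y → (L ⟦ N ⟧) ≈ᴸ (L' ⟦ bbang Y ⟧)

  ≈ᴸ-ρ : ∀ {n m} {L : SLΛ n m} {L'} → L ≈ᴸ L' → ∀ i → ρB L' i ≡ ρΛ L i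
  ≈ᴸ-ρ ◻         i = refl
  ≈ᴸ-ρ (l ⟦ _ ⟧) i = ≈ᴸ-ρ l (suc i)

  ≈ⁿ-plug : ∀ {n m} {L : SLΛ n m} {L'} → L ≈ᴸ L' → ∀ {T U} → T ≈ⁿ U → plugΛ L T ≈ⁿ plugB L' U
  ≈ⁿ-plug ◻          r = r
  ≈ⁿ-plug (l ⟦ r' ⟧) r = es (≈ⁿ-plug l r) r'

  plug-llam-inv : ∀ {n m} (L : SLΛ n m) {T X} → plugΛ L (llam T) ≈ⁿ X →
                  Σ (SLB n m) λ L' → Σ (Bang (suc m)) λ T' → X ≡ plugB L' (blam T') × L ≈ᴸ L' × T ≈ⁿ T'
  plug-llam-inv ◻         (lam r)   = ◻ , _ , refl , ◻ , r
  plug-llam-inv (L ⟦ _ ⟧) (es r r') with plug-llam-inv L r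
  ... | L' , T' , refl , l , t = L' ⟦ _ ⟧ , T' , refl , l ⟦ r' ⟧ , t

  plug-blam-inv : ∀ {n m} (L : SLB n m) {T M} → M ≈ⁿ plugB L (blam T) →
                  Σ (SLΛ n m) λ L' → Σ (Λ (suc m)) λ T' → M ≡ plugΛ L' (llam T') × L' ≈ᴸ L × T' ≈ⁿ T
  plug-blam-inv ◻         (lam r)   = ◻ , _ , refl , ◻ , r
  plug-blam-inv (L ⟦ _ ⟧) (es r r') with plug-blam-inv L r
  ... | L' , T' , refl , l , t = L' ⟦ _ ⟧ , T' , refl , l ⟦ r' ⟧ , t

  -- The s! rule renames along its substitution context, even an empty one.
  s-simulated : ∀ {n} {M : Λ (suc n)} {N X Y} → M ≈ⁿ X → N ≈ⁿ Y →
                sub0Λ M N ≈ⁿ sub0B (renB (ext (λ i → i)) X) Y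
  s-simulated {X = X} r r' rewrite renB-id (ext-id (λ _ → refl)) X = ≈ⁿ-sub0 r r'

  →n-simulated : ∀ {n} {M M' : Λ n} {X} → M →n M' → M ≈ⁿ X → ∃ λ X' → X →! X' × M' ≈ⁿ X'
  →n-simulated (root (dB L M N)) (app r r') with plug-llam-inv L r
  ... | L' , T' , refl , l , t = _ , root (dB L' T' _) , ≈ⁿ-plug l (es t (≈ⁿ-ren (≈ᴸ-ρ l) r'))
  →n-simulated (root (s M N)) (es r r') = _ , root (s! _ ◻ _) , s-simulated r r'
  →n-simulated (lam st) (lam r) with →n-simulated st r
  ... | _ , st' , r₁ = _ , lam st' , lam r₁
  →n-simulated (appl st) (app r r') with →n-simulated st r
  ... | _ , st' , r₁ = _ , appl st' , app r₁ r'
  →n-simulated (appr st) (app r r') with →n-simulated st r'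
  ... | _ , st' , r₁ = _ , appr (bang st') , app r r₁
  →n-simulated (esl st) (es r r') with →n-simulated st r
  ... | _ , st' , r₁ = _ , esl st' , es r₁ r'
  →n-simulated (esr st) (es r r') with →n-simulated st r'
  ... | _ , st' , r₁ = _ , esr (bang st') , es r r₁

  ↦!-simulated : ∀ {n} {X X' : Bang n} {M} → X ↦! X' → M ≈ⁿ X → ∃ λ M' → M →n M' × M' ≈ⁿ X'
  ↦!-simulated (dB L T Z) (app r r') with plug-blam-inv L r
  ... | L' , T' , refl , l , t = _ , root (dB L' T' _) , ≈ⁿ-plug l (es t (≈ⁿ-ren (≈ᴸ-ρ l) r'))
  ↦!-simulated (s! X ◻ _) (es r r') = _ , root (s _ _) , s-simulated r r'
  ↦!-simulated (s! X (_ ⟦ _ ⟧) _) ()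

  →!-simulated : ∀ {n} {X X' : Bang n} {M} → X →! X' → M ≈ⁿ X → ∃ λ M' → M →n M' × M' ≈ⁿ X'
  →!-simulated (root st) r = ↦!-simulated st r
  →!-simulated (lam st) (lam r) with →!-simulated st r
  ... | _ , st' , r₁ = _ , lam st' , lam r₁
  →!-simulated (appl st) (app r r') with →!-simulated st r
  ... | _ , st' , r₁ = _ , appl st' , app r₁ r'
  →!-simulated (appr (bang st)) (app r r') with →!-simulated st r'
  ... | _ , st' , r₁ = _ , appr st' , app r r₁
  →!-simulated (esl st) (es r r') with →!-simulated st r
  ... | _ , st' , r₁ = _ , esl st' , es r₁ r'
  →!-simulated (esr (bang st)) (es r r') with →!-simulated st r'
  ... | _ , st' , r₁ = _ , esr st' , es r r₁
  →!-simulated (appr (root ())) (app r r')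
  →!-simulated (esr (root ())) (es r r')

  ⁿ-mono : ∀ {n} {A N : Λ n} → A ⊑Λ N → (A ⁿ) ⊑B (N ⁿ)
  ⁿ-mono bot       = bot
  ⁿ-mono var       = var
  ⁿ-mono (lam p)   = lam (ⁿ-mono p)
  ⁿ-mono (app p q) = app (ⁿ-mono p) (bang (ⁿ-mono q))
  ⁿ-mono (es p q)  = es (ⁿ-mono p) (bang (ⁿ-mono q))

  mutual
    approximant-pullback : ∀ {n} {B X : Bang n} {N} → IsA! B → B ⊑B X → N ≈ⁿ X →
                           ∃ λ A → IsAn A × A ⊑Λ N × B ⊑B (A ⁿ)
    approximant-pullback bot q r = lbot , bot , bot , bot
    approximant-pullback (neu b) q r with neutral-pullback b q r
    ... | A , a , p , q' = A , neu a , p , q'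
    approximant-pullback (lam b) (lam q) (lam r) with approximant-pullback b q r
    ... | A , a , p , q' = llam A , lam a , lam p , lam q'
    approximant-pullback (es b ()) (es q bot) (es r r')
    approximant-pullback (es b ()) (es q (bang q')) (es r r')
    approximant-pullback (bang b) (bang q) ()

    neutral-pullback : ∀ {n} {B X : Bang n} {N} → IsAne B → B ⊑B X → N ≈ⁿ X →
                       ∃ λ A → IsNλ A × A ⊑Λ N × B ⊑B (A ⁿ)
    neutral-pullback var var var = _ , var , var , var
    neutral-pullback (app b b') (app q bot) (app r r') with neutral-pullback b q r
    ... | A , a , p , q₁ = lapp A lbot , app a bot , app p bot , app q₁ bot
    neutral-pullback (app b (bang b')) (app q (bang q')) (app r r')
      with neutral-pullback b q r | approximant-pullback b' q' r'
    ... | A , a , p , q₁ | A' , a' , p' , q₁' = lapp A A' , app a a' , app p p' , app q₁ (bang q₁')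
    neutral-pullback (app b (neu ())) (app q (bang q')) (app r r')
    neutral-pullback (es b ()) (es q bot) (es r r')
    neutral-pullback (es b ()) (es q (bang q')) (es r r')

  BT-commutes : ∀ {n} (M : Λ n) → BTnⁿ M ≡ᵀ BT! (M ⁿ)
  BT-commutes M B B-approx = to , from
    where
    to : BTnⁿ M B → BT! (M ⁿ) B
    to (A , (_ , N , M↠N , A⊑N) , B⊑Aⁿ) with lockstep-simulation →n-simulated M↠N (≈ⁿ-translation M)
    ... | X , Mⁿ↠X , N≈X =
      X , Mⁿ↠X , ⊑B-trans B⊑Aⁿ (subst (A ⁿ ⊑B_) (sym (≈ⁿ-functional N≈X)) (ⁿ-mono A⊑N))

    from : BT! (M ⁿ) B → BTnⁿ M B
    from (X , Mⁿ↠X , B⊑X) with lockstep-simulation →!-simulated Mⁿ↠X (≈ⁿ-translation M)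
    ... | N , M↠N , N≈X with approximant-pullback B-approx B⊑X N≈X
    ...   | A , a , A⊑N , B⊑Aⁿ = A , (a , N , M↠N , A⊑N) , B⊑Aⁿ

module CallByValue where

  _↠!_ : ∀ {n} → Bang n → Bang n → Set
  _↠!_ = Star _→!_

  _↠v_ : ∀ {n} → Λ n → Λ n → Set
  _↠v_ = Star _→v_

  ↠!-lam : ∀ {n} {X X' : Bang (suc n)} → X ↠! X' → blam X ↠! blam X'
  ↠!-lam = gmap blam lam

  ↠!-bang : ∀ {n} {X X' : Bang n} → X ↠! X' → bbang X ↠! bbang X'
  ↠!-bang = gmap bbang bang

  ↠!-der : ∀ {n} {X X' : Bang n} → X ↠! X' → bder X ↠! bder X'
  ↠!-der = gmap bder der

  ↠!-appˡ : ∀ {n} {X X' Y : Bang n} → X ↠! X' → bapp X Y ↠! bapp X' Y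
  ↠!-appˡ = gmap _ appl

  ↠!-appʳ : ∀ {n} {X Y Y' : Bang n} → Y ↠! Y' → bapp X Y ↠! bapp X Y'
  ↠!-appʳ = gmap _ appr

  ↠!-esˡ : ∀ {n} {X X' : Bang (suc n)} {Y : Bang n} → X ↠! X' → bes X Y ↠! bes X' Y
  ↠!-esˡ = gmap _ esl

  ↠!-esʳ : ∀ {n} {X : Bang (suc n)} {Y Y' : Bang n} → Y ↠! Y' → bes X Y ↠! bes X Y'
  ↠!-esʳ = gmap _ esr

  ↠v-lam : ∀ {n} {M M' : Λ (suc n)} → M ↠v M' → llam M ↠v llam M'
  ↠v-lam = gmap llam lam

  ↠v-appˡ : ∀ {n} {M M' N : Λ n} → M ↠v M' → lapp M N ↠v lapp M' N
  ↠v-appˡ = gmap _ appl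

  ↠v-appʳ : ∀ {n} {M N N' : Λ n} → N ↠v N' → lapp M N ↠v lapp M N'
  ↠v-appʳ = gmap _ appr

  ↠v-esˡ : ∀ {n} {M M' : Λ (suc n)} {N : Λ n} → M ↠v M' → les M N ↠v les M' N
  ↠v-esˡ = gmap _ esl

  ↠v-esʳ : ∀ {n} {M : Λ (suc n)} {N N' : Λ n} → N ↠v N' → les M N ↠v les M N'
  ↠v-esʳ = gmap _ esr

  -- Reduction can substitute a value into an application head, so ≈ᵛ also admits the der(…) form
  -- of (M N)ᵛ when M is value-headed.  M ≈ˢ P mirrors the first case of appᵛ: M = L⟨V⟩ for a
  -- value V, and P = L'⟨P'⟩ where L⟨V⟩ is related to L'⟨!P'⟩.
  mutual
    data _≈ᵛ_ : ∀ {n} → Λ n → Bang n → Set where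
      var  : ∀ {n} {i : Fin n} → lvar i ≈ᵛ bbang (bvar i)
      lam  : ∀ {n} {M : Λ (suc n)} {X} → M ≈ᵛ X → llam M ≈ᵛ bbang (blam X)
      es   : ∀ {n} {M : Λ (suc n)} {N : Λ n} {X Y} → M ≈ᵛ X → N ≈ᵛ Y → les M N ≈ᵛ bes X Y
      appˢ : ∀ {n} {M N : Λ n} {X Y} → M ≈ˢ X → N ≈ᵛ Y → lapp M N ≈ᵛ bapp X Y
      appᵈ : ∀ {n} {M N : Λ n} {X Y} → M ≈ᵛ X → N ≈ᵛ Y → lapp M N ≈ᵛ bapp (bder X) Y
      bot  : ∀ {n} → lbot {n} ≈ᵛ bbot

    data _≈ˢ_ : ∀ {n} → Λ n → Bang n → Set where
      var : ∀ {n} {i : Fin n} → lvar i ≈ˢ bvar i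
      lam : ∀ {n} {M : Λ (suc n)} {X} → M ≈ᵛ X → llam M ≈ˢ blam X
      es  : ∀ {n} {M : Λ (suc n)} {N : Λ n} {X Y} → M ≈ˢ X → N ≈ᵛ Y → les M N ≈ˢ bes X Y

  _≈!_ : ∀ {n} → Λ n → Bang n → Set
  V ≈! Q = V ≈ᵛ bbang Q × V ≈ˢ Q

  mutual
    ≈ᵛ-ren : ∀ {n m} {ρ ρ' : Fin n → Fin m} → (∀ i → ρ' i ≡ ρ i) →
             ∀ {M X} → M ≈ᵛ X → renΛ ρ M ≈ᵛ renB ρ' X
    ≈ᵛ-ren h (var {i = i}) rewrite h i = var
    ≈ᵛ-ren h (lam r)     = lam (≈ᵛ-ren (ext-cong h) r)
    ≈ᵛ-ren h (es r r')   = es (≈ᵛ-ren (ext-cong h) r) (≈ᵛ-ren h r')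
    ≈ᵛ-ren h (appˢ r r') = appˢ (≈ˢ-ren h r) (≈ᵛ-ren h r')
    ≈ᵛ-ren h (appᵈ r r') = appᵈ (≈ᵛ-ren h r) (≈ᵛ-ren h r')
    ≈ᵛ-ren h bot         = bot

    ≈ˢ-ren : ∀ {n m} {ρ ρ' : Fin n → Fin m} → (∀ i → ρ' i ≡ ρ i) →
             ∀ {M X} → M ≈ˢ X → renΛ ρ M ≈ˢ renB ρ' X
    ≈ˢ-ren h (var {i = i}) rewrite h i = var
    ≈ˢ-ren h (lam r)   = lam (≈ᵛ-ren (ext-cong h) r)
    ≈ˢ-ren h (es r r') = es (≈ˢ-ren (ext-cong h) r) (≈ᵛ-ren h r')

  ≈!-exts : ∀ {n m} {σ : Fin n → Λ m} {τ : Fin n → Bang m} → (∀ i → σ i ≈! τ i) →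
            ∀ i → extsΛ σ i ≈! extsB τ i
  ≈!-exts h zero    = var , var
  ≈!-exts h (suc i) = let v , w = h i in ≈ᵛ-ren (λ _ → refl) v , ≈ˢ-ren (λ _ → refl) w

  mutual
    ≈ᵛ-sub : ∀ {n m} {σ : Fin n → Λ m} {τ : Fin n → Bang m} → (∀ i → σ i ≈! τ i) →
             ∀ {M X} → M ≈ᵛ X → subΛ σ M ≈ᵛ subB τ X
    ≈ᵛ-sub h var         = proj₁ (h _)
    ≈ᵛ-sub h (lam r)     = lam (≈ᵛ-sub (≈!-exts h) r)
    ≈ᵛ-sub h (es r r')   = es (≈ᵛ-sub (≈!-exts h) r) (≈ᵛ-sub h r')
    ≈ᵛ-sub h (appˢ r r') = appˢ (≈ˢ-sub h r) (≈ᵛ-sub h r')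
    ≈ᵛ-sub h (appᵈ r r') = appᵈ (≈ᵛ-sub h r) (≈ᵛ-sub h r')
    ≈ᵛ-sub h bot         = bot

    ≈ˢ-sub : ∀ {n m} {σ : Fin n → Λ m} {τ : Fin n → Bang m} → (∀ i → σ i ≈! τ i) →
             ∀ {M X} → M ≈ˢ X → subΛ σ M ≈ˢ subB τ X
    ≈ˢ-sub h var       = proj₂ (h _)
    ≈ˢ-sub h (lam r)   = lam (≈ᵛ-sub (≈!-exts h) r)
    ≈ˢ-sub h (es r r') = es (≈ˢ-sub (≈!-exts h) r) (≈ᵛ-sub h r')

  ≈ᵛ-sub0 : ∀ {n} {M : Λ (suc n)} {X V Q} → M ≈ᵛ X → V ≈! Q → sub0Λ M V ≈ᵛ sub0B X Q
  ≈ᵛ-sub0 r v = ≈ᵛ-sub (λ { zero → v ; (suc i) → var , var }) r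

  ≈ˢ-sub0 : ∀ {n} {M : Λ (suc n)} {X V Q} → M ≈ˢ X → V ≈! Q → sub0Λ M V ≈ˢ sub0B X Q
  ≈ˢ-sub0 r v = ≈ˢ-sub (λ { zero → v ; (suc i) → var , var }) r

  data _≈ᴸ_ : ∀ {n m} → SLΛ n m → SLB n m → Set where
    ◻    : ∀ {n} → ◻ {n} ≈ᴸ ◻
    _⟦_⟧ : ∀ {n m} {L : SLΛ (suc n) m} {L' : SLB (suc n) m} {N Y} →
           L ≈ᴸ L' → N ≈ᵛ Y → (L ⟦ N ⟧) ≈ᴸ (L' ⟦ Y ⟧)

  ≈ᴸ-ρ : ∀ {n m} {L : SLΛ n m} {L'} → L ≈ᴸ L' → ∀ i → ρB L' i ≡ ρΛ L i
  ≈ᴸ-ρ ◻         i = refl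
  ≈ᴸ-ρ (l ⟦ _ ⟧) i = ≈ᴸ-ρ l (suc i)

  ≈ᵛ-plug : ∀ {n m} {L : SLΛ n m} {L'} → L ≈ᴸ L' → ∀ {T U} → T ≈ᵛ U → plugΛ L T ≈ᵛ plugB L' U
  ≈ᵛ-plug ◻          r = r
  ≈ᵛ-plug (l ⟦ r' ⟧) r = es (≈ᵛ-plug l r) r'

  ≈ˢ-plug : ∀ {n m} {L : SLΛ n m} {L'} → L ≈ᴸ L' → ∀ {T U} → T ≈ˢ U → plugΛ L T ≈ˢ plugB L' U
  ≈ˢ-plug ◻          r = r
  ≈ˢ-plug (l ⟦ r' ⟧) r = es (≈ˢ-plug l r) r'

  plug-value-inv : ∀ {n m} (L : SLΛ n m) {V X} → ValueΛ V → plugΛ L V ≈ᵛ X →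
                   Σ (SLB n m) λ L' → Σ (Bang m) λ Q → X ≡ plugB L' (bbang Q) × L ≈ᴸ L' × V ≈! Q
  plug-value-inv ◻         var var     = ◻ , _ , refl , ◻ , var , var
  plug-value-inv ◻         lam (lam r) = ◻ , _ , refl , ◻ , lam r , lam r
  plug-value-inv (L ⟦ _ ⟧) v (es r r') with plug-value-inv L v r
  ... | L' , Q , refl , l , w = L' ⟦ _ ⟧ , Q , refl , l ⟦ r' ⟧ , w

  plug-bang-inv : ∀ {n m} (L : SLB n m) {Q M} → M ≈ᵛ plugB L (bbang Q) →
                  Σ (SLΛ n m) λ L' → Σ (Λ m) λ V → M ≡ plugΛ L' V × L' ≈ᴸ L × ValueΛ V × V ≈! Q
  plug-bang-inv ◻         var       = ◻ , _ , refl , ◻ , var , var , var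
  plug-bang-inv ◻         (lam r)   = ◻ , _ , refl , ◻ , lam , lam r , lam r
  plug-bang-inv (L ⟦ _ ⟧) (es r r') with plug-bang-inv L r
  ... | L' , V , refl , l , v , w = L' ⟦ _ ⟧ , V , refl , l ⟦ r' ⟧ , v , w

  plug-llam-inv : ∀ {n m} (L : SLΛ n m) {T X} → plugΛ L (llam T) ≈ˢ X →
                  Σ (SLB n m) λ L' → Σ (Bang (suc m)) λ T' → X ≡ plugB L' (blam T') × L ≈ᴸ L' × T ≈ᵛ T'
  plug-llam-inv ◻         (lam r)   = ◻ , _ , refl , ◻ , r
  plug-llam-inv (L ⟦ _ ⟧) (es r r') with plug-llam-inv L r
  ... | L' , T' , refl , l , t = L' ⟦ _ ⟧ , T' , refl , l ⟦ r' ⟧ , t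

  plug-blam-inv : ∀ {n m} (L : SLB n m) {T M} → M ≈ˢ plugB L (blam T) →
                  Σ (SLΛ n m) λ L' → Σ (Λ (suc m)) λ T' → M ≡ plugΛ L' (llam T') × L' ≈ᴸ L × T' ≈ᵛ T
  plug-blam-inv ◻         (lam r)   = ◻ , _ , refl , ◻ , r
  plug-blam-inv (L ⟦ _ ⟧) (es r r') with plug-blam-inv L r
  ... | L' , T' , refl , l , t = L' ⟦ _ ⟧ , T' , refl , l ⟦ r' ⟧ , t

  sv-simulatedᵛ : ∀ {n m} {L : SLΛ n m} {L'} {M X} {V : Λ m} {Q} → L ≈ᴸ L' → M ≈ᵛ X → V ≈! Q →
                  plugΛ L (sub0Λ (renΛ (ext (ρΛ L)) M) V) ≈ᵛ plugB L' (sub0B (renB (ext (ρB L')) X) Q)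
  sv-simulatedᵛ l r v = ≈ᵛ-plug l (≈ᵛ-sub0 (≈ᵛ-ren (ext-cong (≈ᴸ-ρ l)) r) v)

  sv-simulatedˢ : ∀ {n m} {L : SLΛ n m} {L'} {M X} {V : Λ m} {Q} → L ≈ᴸ L' → M ≈ˢ X → V ≈! Q →
                  plugΛ L (sub0Λ (renΛ (ext (ρΛ L)) M) V) ≈ˢ plugB L' (sub0B (renB (ext (ρB L')) X) Q)
  sv-simulatedˢ l r v = ≈ˢ-plug l (≈ˢ-sub0 (≈ˢ-ren (ext-cong (≈ᴸ-ρ l)) r) v)

  dB-simulated : ∀ {n m} {L : SLΛ n m} {L'} {T X} {N : Λ n} {Y} → L ≈ᴸ L' → T ≈ᵛ X → N ≈ᵛ Y →
                 plugΛ L (les T (renΛ (ρΛ L) N)) ≈ᵛ plugB L' (bes X (renB (ρB L') Y))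
  dB-simulated l t r = ≈ᵛ-plug l (es t (≈ᵛ-ren (≈ᴸ-ρ l) r))

  -- A der(…)-headed redex first needs the d! step that exposes the abstraction.
  ↦v-simulatedᵛ : ∀ {n} {M M' : Λ n} {X} → M ↦v M' → M ≈ᵛ X → ∃ λ X' → X ↠! X' × M' ≈ᵛ X'
  ↦v-simulatedᵛ (dB L T N) (appˢ r r') with plug-llam-inv L r
  ... | L' , T' , refl , l , t = _ , return (root (dB L' T' _)) , dB-simulated l t r'
  ↦v-simulatedᵛ (dB L T N) (appᵈ r r') with plug-value-inv L lam r
  ... | L' , _ , refl , l , lam t , _ =
    _ , appl (root (d! L' _)) ◅ return (root (dB L' _ _)) , dB-simulated l t r'
  ↦v-simulatedᵛ (sv M L V v) (es r r') with plug-value-inv L v r'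
  ... | L' , Q , refl , l , w = _ , return (root (s! _ L' Q)) , sv-simulatedᵛ l r w

  ↦v-simulatedˢ : ∀ {n} {M M' : Λ n} {X} → M ↦v M' → M ≈ˢ X → ∃ λ X' → X ↠! X' × M' ≈ˢ X'
  ↦v-simulatedˢ (sv M L V v) (es r r') with plug-value-inv L v r'
  ... | L' , Q , refl , l , w = _ , return (root (s! _ L' Q)) , sv-simulatedˢ l r w

  mutual
    →v-simulatedᵛ : ∀ {n} {M M' : Λ n} {X} → M →v M' → M ≈ᵛ X → ∃ λ X' → X ↠! X' × M' ≈ᵛ X'
    →v-simulatedᵛ (root st) r = ↦v-simulatedᵛ st r
    →v-simulatedᵛ (lam st) (lam r) with →v-simulatedᵛ st r
    ... | _ , sts , r₁ = _ , ↠!-bang (↠!-lam sts) , lam r₁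
    →v-simulatedᵛ (appl st) (appˢ r r') with →v-simulatedˢ st r
    ... | _ , sts , r₁ = _ , ↠!-appˡ sts , appˢ r₁ r'
    →v-simulatedᵛ (appl st) (appᵈ r r') with →v-simulatedᵛ st r
    ... | _ , sts , r₁ = _ , ↠!-appˡ (↠!-der sts) , appᵈ r₁ r'
    →v-simulatedᵛ (appr st) (appˢ r r') with →v-simulatedᵛ st r'
    ... | _ , sts , r₁ = _ , ↠!-appʳ sts , appˢ r r₁
    →v-simulatedᵛ (appr st) (appᵈ r r') with →v-simulatedᵛ st r'
    ... | _ , sts , r₁ = _ , ↠!-appʳ sts , appᵈ r r₁
    →v-simulatedᵛ (esl st) (es r r') with →v-simulatedᵛ st r
    ... | _ , sts , r₁ = _ , ↠!-esˡ sts , es r₁ r'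
    →v-simulatedᵛ (esr st) (es r r') with →v-simulatedᵛ st r'
    ... | _ , sts , r₁ = _ , ↠!-esʳ sts , es r r₁

    →v-simulatedˢ : ∀ {n} {M M' : Λ n} {X} → M →v M' → M ≈ˢ X → ∃ λ X' → X ↠! X' × M' ≈ˢ X'
    →v-simulatedˢ (root st) r = ↦v-simulatedˢ st r
    →v-simulatedˢ (lam st) (lam r) with →v-simulatedᵛ st r
    ... | _ , sts , r₁ = _ , ↠!-lam sts , lam r₁
    →v-simulatedˢ (esl st) (es r r') with →v-simulatedˢ st r
    ... | _ , sts , r₁ = _ , ↠!-esˡ sts , es r₁ r'
    →v-simulatedˢ (esr st) (es r r') with →v-simulatedᵛ st r'
    ... | _ , sts , r₁ = _ , ↠!-esʳ sts , es r r₁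

  dB-simulated⁻¹ : ∀ {n m} (L : SLB n m) {T Y} {M N : Λ n} → M ≈ˢ plugB L (blam T) → N ≈ᵛ Y →
                   ∃ λ M' → lapp M N ↠v M' × M' ≈ᵛ plugB L (bes T (renB (ρB L) Y))
  dB-simulated⁻¹ L r r' with plug-blam-inv L r
  ... | L' , T' , refl , l , t = _ , return (root (dB L' T' _)) , dB-simulated l t r'

  ↦!-simulatedᵛ : ∀ {n} {X X' : Bang n} {M} → X ↦! X' → M ≈ᵛ X → ∃ λ M' → M ↠v M' × M' ≈ᵛ X'
  ↦!-simulatedᵛ (dB ◻ T Z)         (appˢ r r') = dB-simulated⁻¹ ◻ r r'
  ↦!-simulatedᵛ (dB (L ⟦ Y ⟧) T Z) (appˢ r r') = dB-simulated⁻¹ (L ⟦ Y ⟧) r r'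
  ↦!-simulatedᵛ (s! X L Q) (es r r') with plug-bang-inv L r'
  ... | L' , V , refl , l , v , w = _ , return (root (sv _ L' V v)) , sv-simulatedᵛ l r w

  ↦!-simulatedˢ : ∀ {n} {X X' : Bang n} {M} → X ↦! X' → M ≈ˢ X → ∃ λ M' → M ↠v M' × M' ≈ˢ X'
  ↦!-simulatedˢ (s! X L Q) (es r r') with plug-bang-inv L r'
  ... | L' , V , refl , l , v , w = _ , return (root (sv _ L' V v)) , sv-simulatedˢ l r w

  -- A d! step turning der(L⟨!P⟩) N into L⟨P⟩ N is matched by no source step.
  mutual
    →!-simulatedᵛ : ∀ {n} {X X' : Bang n} {M} → X →! X' → M ≈ᵛ X → ∃ λ M' → M ↠v M' × M' ≈ᵛ X'
    →!-simulatedᵛ (root st) r = ↦!-simulatedᵛ st r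
    →!-simulatedᵛ (bang (lam st)) (lam r) with →!-simulatedᵛ st r
    ... | _ , sts , r₁ = _ , ↠v-lam sts , lam r₁
    →!-simulatedᵛ (esl st) (es r r') with →!-simulatedᵛ st r
    ... | _ , sts , r₁ = _ , ↠v-esˡ sts , es r₁ r'
    →!-simulatedᵛ (esr st) (es r r') with →!-simulatedᵛ st r'
    ... | _ , sts , r₁ = _ , ↠v-esʳ sts , es r r₁
    →!-simulatedᵛ (appl st) (appˢ r r') with →!-simulatedˢ st r
    ... | _ , sts , r₁ = _ , ↠v-appˡ sts , appˢ r₁ r'
    →!-simulatedᵛ (appr st) (appˢ r r') with →!-simulatedᵛ st r'
    ... | _ , sts , r₁ = _ , ↠v-appʳ sts , appˢ r r₁
    →!-simulatedᵛ (appl (der st)) (appᵈ r r') with →!-simulatedᵛ st r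
    ... | _ , sts , r₁ = _ , ↠v-appˡ sts , appᵈ r₁ r'
    →!-simulatedᵛ (appl (root (d! L Q))) (appᵈ r r') with plug-bang-inv L r
    ... | L' , V , refl , l , v , _ , w = _ , ε , appˢ (≈ˢ-plug l w) r'
    →!-simulatedᵛ (appr st) (appᵈ r r') with →!-simulatedᵛ st r'
    ... | _ , sts , r₁ = _ , ↠v-appʳ sts , appᵈ r r₁
    →!-simulatedᵛ (bang (root ())) var
    →!-simulatedᵛ (bang (root ())) (lam r)

    →!-simulatedˢ : ∀ {n} {X X' : Bang n} {M} → X →! X' → M ≈ˢ X → ∃ λ M' → M ↠v M' × M' ≈ˢ X'
    →!-simulatedˢ (root st) r = ↦!-simulatedˢ st r
    →!-simulatedˢ (lam st) (lam r) with →!-simulatedᵛ st r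
    ... | _ , sts , r₁ = _ , ↠v-lam sts , lam r₁
    →!-simulatedˢ (esl st) (es r r') with →!-simulatedˢ st r
    ... | _ , sts , r₁ = _ , ↠v-esˡ sts , es r₁ r'
    →!-simulatedˢ (esr st) (es r r') with →!-simulatedᵛ st r'
    ... | _ , sts , r₁ = _ , ↠v-esʳ sts , es r r₁

  ≈ᵛ-split : ∀ {n m} {M : Λ n} {X} {L : SLB n m} {P} → M ≈ᵛ X → splitBang X ≡ just (m , L , P) →
             M ≈ˢ plugB L P
  ≈ᵛ-split var refl = var
  ≈ᵛ-split (lam r) refl = lam r
  ≈ᵛ-split (es {X = X} r r') eq with splitBang X in e
  ≈ᵛ-split (es r r') refl | just _ = es (≈ᵛ-split r e) r'
  ≈ᵛ-split (es r r') ()   | nothing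
  ≈ᵛ-split (appˢ r r') ()
  ≈ᵛ-split (appᵈ r r') ()
  ≈ᵛ-split bot ()

  ≈ᵛ-translation : ∀ {n} (M : Λ n) → M ≈ᵛ (M ᵛ)
  ≈ᵛ-translation (lvar i) = var
  ≈ᵛ-translation (llam M) = lam (≈ᵛ-translation M)
  ≈ᵛ-translation (lapp M N) with splitBang (M ᵛ) in e
  ... | just _  = appˢ (≈ᵛ-split (≈ᵛ-translation M) e) (≈ᵛ-translation N)
  ... | nothing = appᵈ (≈ᵛ-translation M) (≈ᵛ-translation N)
  ≈ᵛ-translation (les M N) = es (≈ᵛ-translation M) (≈ᵛ-translation N)
  ≈ᵛ-translation lbot = bot

  data AppHeaded : ∀ {n} → Λ n → Set where
    app : ∀ {n} {M N : Λ n} → AppHeaded (lapp M N)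
    es  : ∀ {n} {M : Λ (suc n)} {N} → AppHeaded M → AppHeaded (les M N)

  AppHeaded-⊑ : ∀ {n} {A N : Λ n} → AppHeaded A → A ⊑Λ N → AppHeaded N
  AppHeaded-⊑ app    (app _ _) = app
  AppHeaded-⊑ (es h) (es p _)  = es (AppHeaded-⊑ h p)

  AppHeaded-≉ˢ : ∀ {n} {N : Λ n} {X} → AppHeaded N → N ≈ˢ X → Empty
  AppHeaded-≉ˢ (es h) (es r _) = AppHeaded-≉ˢ h r

  AppHeaded-split : ∀ {n} {A : Λ n} → AppHeaded A → splitBang (A ᵛ) ≡ nothing
  AppHeaded-split (app {M = M}) with splitBang (M ᵛ)
  ... | just _  = refl
  ... | nothing = refl
  AppHeaded-split (es h) rewrite AppHeaded-split h = refl

  split-nothing⇒AppHeaded : ∀ {n} {A : Λ n} → IsAλ A → splitBang (A ᵛ) ≡ nothing → AppHeaded A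
  split-nothing⇒AppHeaded var ()
  split-nothing⇒AppHeaded (app _ _) _ = app
  split-nothing⇒AppHeaded (es {A = A} a _) eq with splitBang (A ᵛ) in e
  split-nothing⇒AppHeaded (es a _) () | just _
  split-nothing⇒AppHeaded (es a _) _  | nothing = es (split-nothing⇒AppHeaded a e)

  IsAxλ⇒IsAλ : ∀ {n} {A : Λ n} → IsAxλ A → IsAλ A
  IsAxλ⇒IsAλ (app a b) = app a b
  IsAxλ⇒IsAλ (es a b)  = es (IsAxλ⇒IsAλ a) b

  IsAxλ⇒AppHeaded : ∀ {n} {A : Λ n} → IsAxλ A → AppHeaded A
  IsAxλ⇒AppHeaded (app _ _) = app
  IsAxλ⇒AppHeaded (es a _)  = es (IsAxλ⇒AppHeaded a)

  -- The restriction of ≈ᵛ/≈ˢ whose der(…) case requires an application head: on approximants it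
  -- is exactly the graph of ᵛ.
  mutual
    data _≐ᵛ_ : ∀ {n} → Λ n → Bang n → Set where
      var  : ∀ {n} {i : Fin n} → lvar i ≐ᵛ bbang (bvar i)
      lam  : ∀ {n} {M : Λ (suc n)} {X} → M ≐ᵛ X → llam M ≐ᵛ bbang (blam X)
      es   : ∀ {n} {M : Λ (suc n)} {N : Λ n} {X Y} → M ≐ᵛ X → N ≐ᵛ Y → les M N ≐ᵛ bes X Y
      appˢ : ∀ {n} {M N : Λ n} {X Y} → M ≐ˢ X → N ≐ᵛ Y → lapp M N ≐ᵛ bapp X Y
      appᵈ : ∀ {n} {M N : Λ n} {X Y} → AppHeaded M → M ≐ᵛ X → N ≐ᵛ Y → lapp M N ≐ᵛ bapp (bder X) Y
      bot  : ∀ {n} → lbot {n} ≐ᵛ bbot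

    data _≐ˢ_ : ∀ {n} → Λ n → Bang n → Set where
      var : ∀ {n} {i : Fin n} → lvar i ≐ˢ bvar i
      lam : ∀ {n} {M : Λ (suc n)} {X} → M ≐ᵛ X → llam M ≐ˢ blam X
      es  : ∀ {n} {M : Λ (suc n)} {N : Λ n} {X Y} → M ≐ˢ X → N ≐ᵛ Y → les M N ≐ˢ bes X Y

  ≐ᵛ-split : ∀ {n m} {M : Λ n} {X} {L : SLB n m} {P} → M ≐ᵛ X → splitBang X ≡ just (m , L , P) →
             M ≐ˢ plugB L P
  ≐ᵛ-split var refl = var
  ≐ᵛ-split (lam r) refl = lam r
  ≐ᵛ-split (es {X = X} r r') eq with splitBang X in e
  ≐ᵛ-split (es r r') refl | just _ = es (≐ᵛ-split r e) r'
  ≐ᵛ-split (es r r') ()   | nothing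
  ≐ᵛ-split (appˢ r r') ()
  ≐ᵛ-split (appᵈ h r r') ()
  ≐ᵛ-split bot ()

  ≐ᵛ-app : ∀ {n} {A B : Λ n} → IsAλ A → A ≐ᵛ (A ᵛ) → B ≐ᵛ (B ᵛ) → lapp A B ≐ᵛ (lapp A B ᵛ)
  ≐ᵛ-app {A = A} a r r' with splitBang (A ᵛ) in e
  ... | just _  = appˢ (≐ᵛ-split r e) r'
  ... | nothing = appᵈ (split-nothing⇒AppHeaded a e) r r'

  mutual
    ≐ᵛ-translation : ∀ {n} {A : Λ n} → IsAv A → A ≐ᵛ (A ᵛ)
    ≐ᵛ-translation bot      = bot
    ≐ᵛ-translation (neu a)  = ≐ᵛ-translationλ a
    ≐ᵛ-translation (lam a)  = lam (≐ᵛ-translation a)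
    ≐ᵛ-translation (es a b) = es (≐ᵛ-translation a) (≐ᵛ-translationxλ b)

    ≐ᵛ-translationλ : ∀ {n} {A : Λ n} → IsAλ A → A ≐ᵛ (A ᵛ)
    ≐ᵛ-translationλ var      = var
    ≐ᵛ-translationλ (app a b) = ≐ᵛ-app a (≐ᵛ-translationλ a) (≐ᵛ-translation b)
    ≐ᵛ-translationλ (es a b) = es (≐ᵛ-translationλ a) (≐ᵛ-translationxλ b)

    ≐ᵛ-translationxλ : ∀ {n} {A : Λ n} → IsAxλ A → A ≐ᵛ (A ᵛ)
    ≐ᵛ-translationxλ (app a b) = ≐ᵛ-app a (≐ᵛ-translationλ a) (≐ᵛ-translation b)
    ≐ᵛ-translationxλ (es a b)  = es (≐ᵛ-translationxλ a) (≐ᵛ-translationxλ b)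

  mutual
    ≐ᵛ-functional : ∀ {n} {A : Λ n} {Z} → A ≐ᵛ Z → Z ≡ A ᵛ
    ≐ᵛ-functional var = refl
    ≐ᵛ-functional (lam r) = cong (λ X → bbang (blam X)) (≐ᵛ-functional r)
    ≐ᵛ-functional (es r r') = cong₂ bes (≐ᵛ-functional r) (≐ᵛ-functional r')
    ≐ᵛ-functional (appˢ {M = A} r r') with splitBang (A ᵛ) | ≐ˢ-split r
    ... | just _  | _ , _ , _ , refl , plug≡ = cong₂ bapp (sym plug≡) (≐ᵛ-functional r')
    ... | nothing | _ , _ , _ , () , _
    ≐ᵛ-functional (appᵈ h r r') rewrite AppHeaded-split h =
      cong₂ (λ X Y → bapp (bder X) Y) (≐ᵛ-functional r) (≐ᵛ-functional r')
    ≐ᵛ-functional bot = refl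

    ≐ˢ-split : ∀ {n} {A : Λ n} {Z} → A ≐ˢ Z →
               Σ ℕ λ m → Σ (SLB n m) λ L → Σ (Bang m) λ P → splitBang (A ᵛ) ≡ just (m , L , P) × plugB L P ≡ Z
    ≐ˢ-split var = _ , ◻ , _ , refl , refl
    ≐ˢ-split (lam r) = _ , ◻ , _ , refl , cong blam (sym (≐ᵛ-functional r))
    ≐ˢ-split (es {N = B} r r') with ≐ˢ-split r
    ... | m , L , P , e , plug≡ rewrite e = m , L ⟦ B ᵛ ⟧ , P , refl , cong₂ bes plug≡ (sym (≐ᵛ-functional r'))

  -- ᵛ is not monotone: N ≈ᵛ X may keep a der(L⟨!P⟩) application head that the translation of an
  -- approximant A ⊑ N has already stripped, so X must first perform those d! steps.
  mutual
    reachable-aboveᵛ : ∀ {n} {A N : Λ n} {Z X} → A ≐ᵛ Z → A ⊑Λ N → N ≈ᵛ X → ∃ λ X' → X ↠! X' × Z ⊑B X'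
    reachable-aboveᵛ bot p r = _ , ε , bot
    reachable-aboveᵛ var var var = _ , ε , bang var
    reachable-aboveᵛ (lam c) (lam p) (lam r) with reachable-aboveᵛ c p r
    ... | _ , sts , q = _ , ↠!-bang (↠!-lam sts) , bang (lam q)
    reachable-aboveᵛ (es c c') (es p p') (es r r')
      with reachable-aboveᵛ c p r | reachable-aboveᵛ c' p' r'
    ... | _ , sts , q | _ , sts' , q' = _ , ↠!-esˡ sts ◅◅ ↠!-esʳ sts' , es q q'
    reachable-aboveᵛ (appˢ c c') (app p p') (appˢ r r')
      with reachable-aboveˢ c p r | reachable-aboveᵛ c' p' r'
    ... | _ , sts , q | _ , sts' , q' = _ , ↠!-appˡ sts ◅◅ ↠!-appʳ sts' , app q q'
    reachable-aboveᵛ (appˢ c c') (app p p') (appᵈ r r')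
      with reachable-bang-above c p r | reachable-aboveᵛ c' p' r'
    ... | _ , L , P , sts , q | _ , sts' , q' =
      _ , ↠!-appˡ (↠!-der sts) ◅◅ appl (root (d! L P)) ◅ ↠!-appʳ sts' , app q q'
    reachable-aboveᵛ (appᵈ h c c') (app p p') (appˢ r r') = ⊥-elim (AppHeaded-≉ˢ (AppHeaded-⊑ h p) r)
    reachable-aboveᵛ (appᵈ h c c') (app p p') (appᵈ r r')
      with reachable-aboveᵛ c p r | reachable-aboveᵛ c' p' r'
    ... | _ , sts , q | _ , sts' , q' = _ , ↠!-appˡ (↠!-der sts) ◅◅ ↠!-appʳ sts' , app (der q) q'

    reachable-aboveˢ : ∀ {n} {A N : Λ n} {Z X} → A ≐ˢ Z → A ⊑Λ N → N ≈ˢ X → ∃ λ X' → X ↠! X' × Z ⊑B X'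
    reachable-aboveˢ var var var = _ , ε , var
    reachable-aboveˢ (lam c) (lam p) (lam r) with reachable-aboveᵛ c p r
    ... | _ , sts , q = _ , ↠!-lam sts , lam q
    reachable-aboveˢ (es c c') (es p p') (es r r')
      with reachable-aboveˢ c p r | reachable-aboveᵛ c' p' r'
    ... | _ , sts , q | _ , sts' , q' = _ , ↠!-esˡ sts ◅◅ ↠!-esʳ sts' , es q q'

    reachable-bang-above : ∀ {n} {A N : Λ n} {Z X} → A ≐ˢ Z → A ⊑Λ N → N ≈ᵛ X →
                           Σ ℕ λ m → Σ (SLB n m) λ L → Σ (Bang m) λ P → X ↠! plugB L (bbang P) × Z ⊑B plugB L P
    reachable-bang-above var var var = _ , ◻ , _ , ε , var
    reachable-bang-above (lam c) (lam p) (lam r) with reachable-aboveᵛ c p r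
    ... | _ , sts , q = _ , ◻ , _ , ↠!-bang (↠!-lam sts) , lam q
    reachable-bang-above (es c c') (es p p') (es r r')
      with reachable-bang-above c p r | reachable-aboveᵛ c' p' r'
    ... | m , L , P , sts , q | _ , sts' , q' = m , L ⟦ _ ⟧ , P , ↠!-esˡ sts ◅◅ ↠!-esʳ sts' , es q q'

  mutual
    approximant-pullback : ∀ {n} {B X : Bang n} {N} → IsA! B → B ⊑B X → N ≈ᵛ X →
                           ∃ λ A → ∃ λ Z → IsAv A × A ⊑Λ N × A ≐ᵛ Z × B ⊑B Z
    approximant-pullback bot q r = lbot , bbot , bot , bot , bot , bot
    approximant-pullback (neu b) q r with neutral-pullback b q r
    ... | A , Z , a , p , c , q' = A , Z , neu (IsAxλ⇒IsAλ a) , p , c , q'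
    approximant-pullback (bang b) (bang q) var = _ , _ , neu var , var , var , bang q
    approximant-pullback (bang b) (bang bot) (lam r) = llam lbot , _ , lam bot , lam bot , lam bot , bang bot
    approximant-pullback (bang (lam b)) (bang (lam q)) (lam r) with approximant-pullback b q r
    ... | A , Z , a , p , c , q' = llam A , _ , lam a , lam p , lam c , bang (lam q')
    approximant-pullback (bang (neu ())) (bang (lam q)) (lam r)
    approximant-pullback (lam b) (lam q) ()
    approximant-pullback (es b b') (es q q') (es r r')
      with approximant-pullback b q r | neutral-pullback b' q' r'
    ... | A , Z , a , p , c , q₁ | A' , Z' , a' , p' , c' , q₁' =
      les A A' , _ , es a a' , es p p' , es c c' , es q₁ q₁'

    neutral-pullback : ∀ {n} {B X : Bang n} {N} → IsAne B → B ⊑B X → N ≈ᵛ X →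
                       ∃ λ A → ∃ λ Z → IsAxλ A × A ⊑Λ N × A ≐ᵛ Z × B ⊑B Z
    neutral-pullback (app b b') (app q q') (appˢ r r')
      with neutral-pullbackˢ b q r | approximant-pullback b' q' r'
    ... | A , Z , a , p , c , q₁ | A' , Z' , a' , p' , c' , q₁' =
      lapp A A' , _ , app a a' , app p p' , appˢ c c' , app q₁ q₁'
    neutral-pullback (app (der b) b') (app (der q) q') (appᵈ r r')
      with neutral-pullback b q r | approximant-pullback b' q' r'
    ... | A , Z , a , p , c , q₁ | A' , Z' , a' , p' , c' , q₁' =
      lapp A A' , _ , app (IsAxλ⇒IsAλ a) a' , app p p' , appᵈ (IsAxλ⇒AppHeaded a) c c' , app (der q₁) q₁'
    neutral-pullback (es b b') (es q q') (es r r')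
      with neutral-pullback b q r | neutral-pullback b' q' r'
    ... | A , Z , a , p , c , q₁ | A' , Z' , a' , p' , c' , q₁' =
      les A A' , _ , es a a' , es p p' , es c c' , es q₁ q₁'

    neutral-pullbackˢ : ∀ {n} {B X : Bang n} {N} → IsAne B → B ⊑B X → N ≈ˢ X →
                        ∃ λ A → ∃ λ Z → IsAλ A × A ⊑Λ N × A ≐ˢ Z × B ⊑B Z
    neutral-pullbackˢ var var var = _ , _ , var , var , var , var
    neutral-pullbackˢ (es b b') (es q q') (es r r')
      with neutral-pullbackˢ b q r | neutral-pullback b' q' r'
    ... | A , Z , a , p , c , q₁ | A' , Z' , a' , p' , c' , q₁' =
      les A A' , _ , es a a' , es p p' , es c c' , es q₁ q₁'

  BT-commutes : ∀ {n} (M : Λ n) → BTvᵛ M ≡ᵀ BT! (M ᵛ)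
  BT-commutes M B B-approx = to , from
    where
    to : BTvᵛ M B → BT! (M ᵛ) B
    to (A , (a , N , M↠N , A⊑N) , B⊑Aᵛ) with star-simulation →v-simulatedᵛ M↠N (≈ᵛ-translation M)
    ... | X , Mᵛ↠X , N≈X with reachable-aboveᵛ (≐ᵛ-translation a) A⊑N N≈X
    ...   | X' , X↠X' , Aᵛ⊑X' = X' , Mᵛ↠X ◅◅ X↠X' , ⊑B-trans B⊑Aᵛ Aᵛ⊑X'

    from : BT! (M ᵛ) B → BTvᵛ M B
    from (X , Mᵛ↠X , B⊑X) with star-simulation →!-simulatedᵛ Mᵛ↠X (≈ᵛ-translation M)
    ... | N , M↠N , N≈X with approximant-pullback B-approx B⊑X N≈X
    ...   | A , Z , a , A⊑N , A≐Z , B⊑Z = A , (a , N , M↠N , A⊑N) , subst (B ⊑B_) (≐ᵛ-functional A≐Z) B⊑Z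

mainTheorem6 : ((n : ℕ) (M : Λ n) → PureΛ M → BTnⁿ M ≡ᵀ BT! (M ⁿ))
    × ((n : ℕ) (M : Λ n) → PureΛ M → BTvᵛ M ≡ᵀ BT! (M ᵛ))
mainTheorem6 = (λ _ M _ → CallByName.BT-commutes M) , (λ _ M _ → CallByValue.BT-commutes M)
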